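{- Let $(G,\mathcal{T},(A^\circ,B^\circ),k)$ be a Terminal Separation instance, let $\mathcal{T}'\subseteq\mathcal{T}$ be the set of unresolved pairs, and let $\{s,t\}\in\mathcal{T}'$. Let $(A_s,B_t)$ be a terminal separation of minimum cost among terminal separations extending $(A^\circ\cup\{s\},B^\circ\cup\{t\})$, and $(A_t,B_s)$ one of minimum cost among those extending $(A^\circ\cup\{t\},B^\circ\cup\{s\})$. Suppose that $(A_s,B_t)$ and $(A_t,B_s)$ do not resolve any pair of $\mathcal{T}'$ other than $\{s,t\}$. Then for every set $A$ with $A^\circ\cup\{s\}\subseteq A\subseteq V(G)\setminus B^\circ$ that contains no terminal of a pair in $\mathcal{T}'$ other than $s$, we have $d(A)-d(A^\circ)\ge d(A_s)-d(A^\circ)$. Symmetrically, for every set $B$ with $B^\circ\cup\{s\}\subseteq B\subseteq V(G)\setminus A^\circ$ that contains no terminal of a pair in $\mathcal{T}'$ other than $s$, we have $d(B)-d(B^\circ)\ge d(B_s)-d(B^\circ)$.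
   Context: Graphs may have multiple edges but no loops; $d(X)$ is the number of edges with exactly one endpoint in $X$. A Terminal Separation instance consists of a graph $G$, a set $\mathcal{T}$ of pairwise disjoint pairs of vertices (terminals) each of degree at most one, a terminal separation $(A^\circ,B^\circ)$, and an integer $k$. A terminal separation is a pair $(A,B)$ of disjoint vertex sets such that every pair of $\mathcal{T}$ either has one terminal in $A$ and the other in $B$, or is disjoint from $A\cup B$; $(A',B')$ extends $(A,B)$ if $A\subseteq A'$, $B\subseteq B'$; its cost is $(d(A)+d(B))/2$. A terminal pair is unresolved if it is disjoint from $A^\circ\cup B^\circ$; a separation $(A,B)$ resolves a pair if the pair is contained in $A\cup B$. -}

module Defs where

open import Data.Nat using (ℕ; zero; suc; _+_; _≤_)
open import Data.Bool using (Bool; true; false; if_then_else_; _xor_; _∨_)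
open import Relation.Nullary.Decidable using (⌊_⌋)
import Data.Fin
open import Data.Fin using (Fin)
open import Data.Fin.Subset using (Subset; _∈_; _∉_; _∪_; _⊆_)
open import Data.Vec using (lookup)
open import Data.List using (List; []; _∷_)
open import Data.List.Membership.Propositional using () renaming (_∈_ to _∈ₗ_)
open import Data.List.Relation.Unary.All using (All)
open import Data.Product using (_×_; _,_; proj₁; proj₂)
open import Data.Sum using (_⊎_)
open import Data.Empty using (⊥)
open import Data.Integer as ℤ using (ℤ)
open import Data.Rational as ℚ using (ℚ)
open import Relation.Binary.PropositionalEquality using (_≡_; _≢_)

record Graph : Set where
  field
    n        : ℕ
    edges    : List (Fin n × Fin n)
    loopless : All (λ e → proj₁ e ≢ proj₂ e) edges
open Graph public

cutCount : ∀ {n} → Subset n → List (Fin n × Fin n) → ℕ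
cutCount X [] = 0
cutCount X ((u , v) ∷ es) =
  (if lookup X u xor lookup X v then 1 else 0) + cutCount X es

d : (G : Graph) → Subset (n G) → ℕ
d G X = cutCount X (edges G)

-- number of edges incident to v (no loops, so each counts once)
incCount : ∀ {n} → Fin n → List (Fin n × Fin n) → ℕ
incCount v [] = 0
incCount v ((a , b) ∷ es) =
  (if ⌊ a Data.Fin.≟ v ⌋ ∨ ⌊ b Data.Fin.≟ v ⌋ then 1 else 0) + incCount v es

deg : (G : Graph) → Fin (n G) → ℕ
deg G v = incCount v (edges G)

-- a pair of vertices; {a,b} is represented by (a , b) (unordered reading below)
Pair : ℕ → Set
Pair n = Fin n × Fin n

SamePair : ∀ {n} → Pair n → Pair n → Set
SamePair p q = (p ≡ q) ⊎ (proj₁ p ≡ proj₂ q × proj₂ p ≡ proj₁ q)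

Meets : ∀ {n} → Pair n → Pair n → Set
Meets p q = (proj₁ p ≡ proj₁ q) ⊎ (proj₁ p ≡ proj₂ q) ⊎ (proj₂ p ≡ proj₁ q) ⊎ (proj₂ p ≡ proj₂ q)

Disjoint : ∀ {n} → Subset n → Subset n → Set
Disjoint A B = ∀ x → x ∈ A → x ∈ B → ⊥

ValidTerminals : (G : Graph) → List (Pair (n G)) → Set
ValidTerminals G T =
  (∀ p → p ∈ₗ T → proj₁ p ≢ proj₂ p) ×
  (∀ p q → p ∈ₗ T → q ∈ₗ T → Meets p q → SamePair p q) ×
  (∀ p → p ∈ₗ T → deg G (proj₁ p) ≤ 1 × deg G (proj₂ p) ≤ 1)

IsTermSep : ∀ {n} → List (Pair n) → Subset n → Subset n → Set
IsTermSep T A B =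
  Disjoint A B ×
  (∀ p → p ∈ₗ T →
     ((proj₁ p ∈ A × proj₂ p ∈ B) ⊎ (proj₂ p ∈ A × proj₁ p ∈ B))
     ⊎ (proj₁ p ∉ (A ∪ B) × proj₂ p ∉ (A ∪ B)))

Extends : ∀ {n} → Subset n → Subset n → Subset n → Subset n → Set
Extends A B A' B' = A ⊆ A' × B ⊆ B'

cost : (G : Graph) → Subset (n G) → Subset (n G) → ℚ
cost G A B = ℤ.+ (d G A + d G B) ℚ./ 2

IsMinExt : (G : Graph) → List (Pair (n G)) →
           Subset (n G) → Subset (n G) → Subset (n G) → Subset (n G) → Set
IsMinExt G T X Y A B =
  IsTermSep T A B × Extends X Y A B ×
  (∀ A' B' → IsTermSep T A' B' → Extends X Y A' B' → cost G A B ℚ.≤ cost G A' B')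

record TSInstance : Set where
  field
    graph  : Graph
    terms  : List (Pair (n graph))
    valid  : ValidTerminals graph terms
    A°     : Subset (n graph)
    B°     : Subset (n graph)
    sep°   : IsTermSep terms A° B°
    k      : ℕ
open TSInstance public

Unresolved : ∀ {n} → Subset n → Subset n → Pair n → Set
Unresolved A° B° p = proj₁ p ∉ (A° ∪ B°) × proj₂ p ∉ (A° ∪ B°)

InT' : (I : TSInstance) → Pair (n (graph I)) → Set
InT' I p = p ∈ₗ terms I × Unresolved (A° I) (B° I) p

Resolves : ∀ {n} → Subset n → Subset n → Pair n → Set
Resolves A B p = proj₁ p ∈ (A ∪ B) × proj₂ p ∈ (A ∪ B)

NoOtherTerminal : (I : TSInstance) → Fin (n (graph I)) → Subset (n (graph I)) → Set
NoOtherTerminal I s X =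
  ∀ p → InT' I p →
    (proj₁ p ≢ s → proj₁ p ∉ X) × (proj₂ p ≢ s → proj₂ p ∉ X)

dDiff : (G : Graph) → Subset (n G) → Subset (n G) → ℤ
dDiff G X Y = ℤ.+ (d G X) ℤ.- ℤ.+ (d G Y)

module Submission where

-- A contains the same terminals as A_s (those of A° and s), so (A ─ B_t , B_t) and
-- (A_s , B_t ─ A) are terminal separations extending (A° ∪ {s}, B° ∪ {t}). Comparing
-- (A_s , B_t) with both and using posimodularity d(A ─ B_t) + d(B_t ─ A) ≤ d(A) + d(B_t)
-- gives d(A_s) ≤ d(A). The statement about B is the same one for the instance with
-- A° and B° exchanged.

open import Defs
open import Data.Bool using (Bool; true; false; if_then_else_; _xor_; _∧_; not)
open import Data.Bool.Properties using (∧-zeroʳ; ∧-identityʳ)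
open import Data.Empty using (⊥-elim)
open import Data.Fin using (Fin; zero; suc; _≟_)
open import Data.Fin.Subset using (Subset; inside; outside; ⁅_⁆; _∪_; _─_; _⊆_; _∈_; _∉_)
open import Data.Fin.Subset.Properties using (x∈p∪q⁻; x∈p∪q⁺; x∈⁅x⁆; x∈⁅y⁆⇒x≡y; ∪-comm)
open import Data.Integer using (_≥_)
import Data.Integer as ℤ
import Data.Integer.Properties as ℤ
open import Data.List using (List; []; _∷_)
open import Data.List.Membership.Propositional using () renaming (_∈_ to _∈ₗ_)
open import Data.Nat as ℕ using (ℕ; _≤_; _+_)
import Data.Nat.Properties as ℕ
open import Algebra.Properties.CommutativeSemigroup ℕ.+-commutativeSemigroup using (interchange)
open import Data.Product using (_×_; _,_; proj₁; proj₂)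
open import Data.Sum using (_⊎_; inj₁; inj₂; [_,_])
import Data.Sum as Sum
import Data.Rational as ℚ
import Data.Rational.Properties as ℚ
import Data.Rational.Unnormalised as ℚᵘ
import Data.Rational.Unnormalised.Properties as ℚᵘ
open import Data.Vec using (_∷_; here; there; lookup)
open import Function using (_∘_; _⇔_; mk⇔; Equivalence)
open import Relation.Nullary using (¬_; yes; no)
open import Relation.Binary.PropositionalEquality using (_≡_; _≢_; refl; sym; trans; cong; subst; subst₂)
open Equivalence using (to; from)

private
  variable
    m : ℕ
    T : List (Pair m)
    A B A′ B′ : Subset m
    p : Pair m
    x s t : Fin m

x∈p─q⁺ : {p q : Subset m} → x ∈ p → x ∉ q → x ∈ p ─ q
x∈p─q⁺ {q = inside ∷ q} here x∉q = ⊥-elim (x∉q here)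
x∈p─q⁺ {q = outside ∷ q} here _ = here
x∈p─q⁺ {q = _ ∷ q} (there x∈p) x∉q = there (x∈p─q⁺ x∈p (x∉q ∘ there))

x∈p─q⁻ : (p q : Subset m) {x : Fin m} → x ∈ p ─ q → x ∈ p × x ∉ q
x∈p─q⁻ (inside ∷ p) (outside ∷ q) here = here , λ ()
x∈p─q⁻ (outside ∷ p) (outside ∷ q) {zero} ()
x∈p─q⁻ (_ ∷ p) (inside ∷ q) {zero} ()
x∈p─q⁻ (_ ∷ p) (_ ∷ q) (there x∈p─q) with x∈p─q⁻ p q x∈p─q
... | x∈p , x∉q = there x∈p , λ { (there x∈q) → x∉q x∈q }

lookup-─ : (p q : Subset m) (x : Fin m) → lookup (p ─ q) x ≡ lookup p x ∧ not (lookup q x)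
lookup-─ (b ∷ p) (inside ∷ q) zero = sym (∧-zeroʳ b)
lookup-─ (b ∷ p) (outside ∷ q) zero = sym (∧-identityʳ b)
lookup-─ (_ ∷ p) (_ ∷ q) (suc x) = lookup-─ p q x

∈-∪-comm : (p q : Subset m) → x ∈ p ∪ q → x ∈ q ∪ p
∈-∪-comm p q = subst (_ ∈_) (∪-comm p q)

∉-∪-comm : (p q : Subset m) → x ∉ p ∪ q → x ∉ q ∪ p
∉-∪-comm p q x∉p∪q = x∉p∪q ∘ ∈-∪-comm q p

crossing : Bool → Bool → ℕ
crossing a b = if a xor b then 1 else 0

crossing-posimodular : ∀ a₁ a₂ b₁ b₂ →
  crossing (a₁ ∧ not b₁) (a₂ ∧ not b₂) + crossing (b₁ ∧ not a₁) (b₂ ∧ not a₂)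
    ≤ crossing a₁ a₂ + crossing b₁ b₂
crossing-posimodular true  true  true  true  = ℕ.≤ᵇ⇒≤ _ _ _
crossing-posimodular true  true  true  false = ℕ.≤ᵇ⇒≤ _ _ _
crossing-posimodular true  true  false true  = ℕ.≤ᵇ⇒≤ _ _ _
crossing-posimodular true  true  false false = ℕ.≤ᵇ⇒≤ _ _ _
crossing-posimodular true  false true  true  = ℕ.≤ᵇ⇒≤ _ _ _
crossing-posimodular true  false true  false = ℕ.≤ᵇ⇒≤ _ _ _
crossing-posimodular true  false false true  = ℕ.≤ᵇ⇒≤ _ _ _
crossing-posimodular true  false false false = ℕ.≤ᵇ⇒≤ _ _ _
crossing-posimodular false true  true  true  = ℕ.≤ᵇ⇒≤ _ _ _
crossing-posimodular false true  true  false = ℕ.≤ᵇ⇒≤ _ _ _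
crossing-posimodular false true  false true  = ℕ.≤ᵇ⇒≤ _ _ _
crossing-posimodular false true  false false = ℕ.≤ᵇ⇒≤ _ _ _
crossing-posimodular false false true  true  = ℕ.≤ᵇ⇒≤ _ _ _
crossing-posimodular false false true  false = ℕ.≤ᵇ⇒≤ _ _ _
crossing-posimodular false false false true  = ℕ.≤ᵇ⇒≤ _ _ _
crossing-posimodular false false false false = ℕ.≤ᵇ⇒≤ _ _ _

cutCount-posimodular : (A B : Subset m) (es : List (Fin m × Fin m)) →
  cutCount (A ─ B) es + cutCount (B ─ A) es ≤ cutCount A es + cutCount B es
cutCount-posimodular A B [] = ℕ.z≤n
cutCount-posimodular A B ((u , v) ∷ es) = begin
  (edge (A ─ B) + cutCount (A ─ B) es) + (edge (B ─ A) + cutCount (B ─ A) es)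
    ≡⟨ interchange (edge (A ─ B)) _ (edge (B ─ A)) _ ⟩
  (edge (A ─ B) + edge (B ─ A)) + (cutCount (A ─ B) es + cutCount (B ─ A) es)
    ≤⟨ ℕ.+-mono-≤ edge-posimodular (cutCount-posimodular A B es) ⟩
  (edge A + edge B) + (cutCount A es + cutCount B es)
    ≡⟨ interchange (edge A) (edge B) _ _ ⟩
  (edge A + cutCount A es) + (edge B + cutCount B es) ∎
  where
  open ℕ.≤-Reasoning
  edge : Subset _ → ℕ
  edge X = crossing (lookup X u) (lookup X v)
  edge-posimodular : edge (A ─ B) + edge (B ─ A) ≤ edge A + edge B
  edge-posimodular rewrite lookup-─ A B u | lookup-─ A B v | lookup-─ B A u | lookup-─ B A v =
    crossing-posimodular (lookup A u) (lookup A v) (lookup B u) (lookup B v)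

+/-cancelʳ-≤ : ∀ {i j} k .{{_ : ℕ.NonZero k}} → ℤ.+ i ℚ./ k ℚ.≤ ℤ.+ j ℚ./ k → i ≤ j
+/-cancelʳ-≤ {i} {j} (ℕ.suc k) i/k≤j/k with ℚᵘ.*≤* i*k≤j*k ←
  ℚᵘ.≤-respʳ-≃ (ℚ.toℚᵘ-fromℚᵘ (ℚᵘ.mkℚᵘ (ℤ.+ j) k))
    (ℚᵘ.≤-respˡ-≃ (ℚ.toℚᵘ-fromℚᵘ (ℚᵘ.mkℚᵘ (ℤ.+ i) k)) (ℚ.toℚᵘ-mono-≤ i/k≤j/k))
  = ℤ.drop‿+≤+ (ℤ.*-cancelʳ-≤-pos (ℤ.+ i) (ℤ.+ j) (ℤ.+ ℕ.suc k) i*k≤j*k)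

EndpointOf : Fin m → Pair m → Set
EndpointOf x p = x ≡ proj₁ p ⊎ x ≡ proj₂ p

SameTerminals : List (Pair m) → Subset m → Subset m → Set
SameTerminals T X X′ = ∀ p → p ∈ₗ T → ∀ x → EndpointOf x p → x ∈ X ⇔ x ∈ X′

RespectsPair : Subset m → Subset m → Pair m → Set
RespectsPair A B p =
  ((proj₁ p ∈ A × proj₂ p ∈ B) ⊎ (proj₂ p ∈ A × proj₁ p ∈ B))
  ⊎ (proj₁ p ∉ (A ∪ B) × proj₂ p ∉ (A ∪ B))

SameTerminals-refl : SameTerminals T A A
SameTerminals-refl _ _ _ _ = mk⇔ (λ x∈A → x∈A) (λ x∈A → x∈A)

IsTermSep-swap : IsTermSep T A B → IsTermSep T B A
IsTermSep-swap {A = A} {B = B} (A#B , place) =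
  (λ x x∈B x∈A → A#B x x∈A x∈B) , λ p p∈T → swap (place p p∈T)
  where
  swap : ∀ {p} → RespectsPair A B p → RespectsPair B A p
  swap (inj₁ (inj₁ (a , b))) = inj₁ (inj₂ (b , a))
  swap (inj₁ (inj₂ (a , b))) = inj₁ (inj₁ (b , a))
  swap (inj₂ (a , b))        = inj₂ (∉-∪-comm A B a , ∉-∪-comm A B b)

IsTermSep-cong : IsTermSep T A B → Disjoint A′ B′ →
  SameTerminals T A A′ → SameTerminals T B B′ → IsTermSep T A′ B′
IsTermSep-cong {T = T} {A = A} {B = B} {A′ = A′} {B′ = B′} (_ , place) A′#B′ A≈A′ B≈B′ =
  A′#B′ , λ p p∈T → transport p p∈T (place p p∈T)
  where
  transport : ∀ p → p ∈ₗ T → RespectsPair A B p → RespectsPair A′ B′ p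
  transport p p∈T (inj₁ (inj₁ (a , b))) =
    inj₁ (inj₁ (to (A≈A′ p p∈T _ (inj₁ refl)) a , to (B≈B′ p p∈T _ (inj₂ refl)) b))
  transport p p∈T (inj₁ (inj₂ (a , b))) =
    inj₁ (inj₂ (to (A≈A′ p p∈T _ (inj₂ refl)) a , to (B≈B′ p p∈T _ (inj₁ refl)) b))
  transport p p∈T (inj₂ (a , b)) = inj₂ (stays-out (inj₁ refl) a , stays-out (inj₂ refl) b)
    where
    stays-out : ∀ {x} → EndpointOf x p → x ∉ A ∪ B → x ∉ A′ ∪ B′
    stays-out e x∉A∪B x∈A′∪B′ = x∉A∪B (x∈p∪q⁺
      (Sum.map (from (A≈A′ p p∈T _ e)) (from (B≈B′ p p∈T _ e)) (x∈p∪q⁻ A′ B′ x∈A′∪B′)))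

IsTermSep-resolves : IsTermSep T A B → p ∈ₗ T → EndpointOf x p → x ∈ A ∪ B → Resolves A B p
IsTermSep-resolves {A = A} {B = B} (_ , place) p∈T e x∈A∪B with place _ p∈T | e
... | inj₁ (inj₁ (a , b)) | _ = x∈p∪q⁺ (inj₁ a) , x∈p∪q⁺ (inj₂ b)
... | inj₁ (inj₂ (a , b)) | _ = x∈p∪q⁺ (inj₂ b) , x∈p∪q⁺ (inj₁ a)
... | inj₂ (a , _) | inj₁ refl = ⊥-elim (a x∈A∪B)
... | inj₂ (_ , b) | inj₂ refl = ⊥-elim (b x∈A∪B)

IsTermSep-endpoint : IsTermSep T A B → p ∈ₗ T → EndpointOf x p →
  (x ∈ A ⊎ x ∈ B) ⊎ Unresolved A B p
IsTermSep-endpoint (_ , place) p∈T e with place _ p∈T | e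
... | inj₁ (inj₁ (a , _)) | inj₁ refl = inj₁ (inj₁ a)
... | inj₁ (inj₁ (_ , b)) | inj₂ refl = inj₁ (inj₂ b)
... | inj₁ (inj₂ (_ , b)) | inj₁ refl = inj₁ (inj₂ b)
... | inj₁ (inj₂ (a , _)) | inj₂ refl = inj₁ (inj₁ a)
... | inj₂ u | _ = inj₂ u

Unresolved-swap : Unresolved A B p → Unresolved B A p
Unresolved-swap {A = A} {B = B} (u₁ , u₂) = ∉-∪-comm A B u₁ , ∉-∪-comm A B u₂

Resolves-swap : Resolves A B p → Resolves B A p
Resolves-swap {A = A} {B = B} (r₁ , r₂) = ∈-∪-comm A B r₁ , ∈-∪-comm A B r₂

cost-comm : (G : Graph) (A B : Subset (n G)) → cost G A B ≡ cost G B A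
cost-comm G A B = cong (λ c → ℤ.+ c ℚ./ 2) (ℕ.+-comm (d G A) (d G B))

IsMinExt-swap : (G : Graph) {T : List (Pair (n G))} {X Y P R : Subset (n G)} →
  IsMinExt G T X Y P R → IsMinExt G T Y X R P
IsMinExt-swap G {P = P} {R} (sep , (X⊆P , Y⊆R) , min) =
  IsTermSep-swap sep , (Y⊆R , X⊆P) , λ A′ B′ sep′ (Y⊆B′ , X⊆A′) →
    subst₂ ℚ._≤_ (cost-comm G P R) (cost-comm G B′ A′) (min B′ A′ (IsTermSep-swap sep′) (X⊆A′ , Y⊆B′))

IsMinExt-d+d-≤ : (G : Graph) {T : List (Pair (n G))} {X Y P R A′ B′ : Subset (n G)} →
  IsMinExt G T X Y P R → IsTermSep T A′ B′ → Extends X Y A′ B′ →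
  d G P + d G R ≤ d G A′ + d G B′
IsMinExt-d+d-≤ G (_ , _ , min) sep′ ext′ = +/-cancelʳ-≤ 2 (min _ _ sep′ ext′)

IsMinExt-d-≤ : (G : Graph) {T : List (Pair (n G))} {X Y P R A : Subset (n G)} →
  IsMinExt G T X Y P R → X ⊆ A → Disjoint A Y → SameTerminals T P A → d G P ≤ d G A
IsMinExt-d-≤ G {T} {X} {Y} {P} {R} {A} min@(sep@(P#R , _) , (X⊆P , Y⊆R) , _) X⊆A A#Y P≈A =
  ℕ.+-cancelʳ-≤ (d G R) (d G P) (d G A) (begin
    d G P + d G R             ≤⟨ ℕ.+-mono-≤ dP≤dA─R dR≤dR─A ⟩
    d G (A ─ R) + d G (R ─ A) ≤⟨ cutCount-posimodular A R (edges G) ⟩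
    d G A + d G R             ∎)
  where
  open ℕ.≤-Reasoning
  P≈A─R : SameTerminals T P (A ─ R)
  P≈A─R p p∈T x e = mk⇔
    (λ x∈P → x∈p─q⁺ (to (P≈A p p∈T x e) x∈P) (P#R x x∈P))
    (from (P≈A p p∈T x e) ∘ proj₁ ∘ x∈p─q⁻ A R)
  R≈R─A : SameTerminals T R (R ─ A)
  R≈R─A p p∈T x e = mk⇔
    (λ x∈R → x∈p─q⁺ x∈R (λ x∈A → P#R x (from (P≈A p p∈T x e) x∈A) x∈R))
    (proj₁ ∘ x∈p─q⁻ R A)
  dP≤dA─R : d G P ≤ d G (A ─ R)
  dP≤dA─R = ℕ.+-cancelʳ-≤ (d G R) _ _ (IsMinExt-d+d-≤ G min
    (IsTermSep-cong sep (λ x x∈A─R → proj₂ (x∈p─q⁻ A R x∈A─R)) P≈A─R SameTerminals-refl)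
    ((λ x∈X → x∈p─q⁺ (X⊆A x∈X) (P#R _ (X⊆P x∈X))) , Y⊆R))
  dR≤dR─A : d G R ≤ d G (R ─ A)
  dR≤dR─A = ℕ.+-cancelˡ-≤ (d G P) _ _ (IsMinExt-d+d-≤ G min
    (IsTermSep-cong sep (λ x x∈P → P#R x x∈P ∘ proj₁ ∘ x∈p─q⁻ R A) SameTerminals-refl R≈R─A)
    (X⊆P , λ y∈Y → x∈p─q⁺ (Y⊆R y∈Y) (λ y∈A → A#Y _ y∈A y∈Y)))

dDiff-monoˡ : (G : Graph) {X X′ : Subset (n G)} (Y : Subset (n G)) →
  d G X ≤ d G X′ → dDiff G X′ Y ≥ dDiff G X Y
dDiff-monoˡ G Y dX≤dX′ = ℤ.+-monoˡ-≤ (ℤ.- ℤ.+ d G Y) (ℤ.+≤+ dX≤dX′)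

SamePair-endpoint : SamePair p (s , t) → EndpointOf x p → x ≡ s ⊎ x ≡ t
SamePair-endpoint (inj₁ refl) (inj₁ x≡s) = inj₁ x≡s
SamePair-endpoint (inj₁ refl) (inj₂ x≡t) = inj₂ x≡t
SamePair-endpoint (inj₂ (p₁≡t , _)) (inj₁ x≡p₁) = inj₂ (trans x≡p₁ p₁≡t)
SamePair-endpoint (inj₂ (_ , p₂≡s)) (inj₂ x≡p₂) = inj₁ (trans x≡p₂ p₂≡s)

module _ (I : TSInstance) where

  private
    G = graph I
    V = Subset (n G)

  NoOtherTerminal-endpoint : {s x : Fin (n G)} {A : V} {p : Pair (n G)} →
    NoOtherTerminal I s A → InT' I p → EndpointOf x p → x ∈ A → x ≡ s
  NoOtherTerminal-endpoint {s} {x} noOther q e x∈A with x ≟ s | e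
  ... | yes x≡s | _        = x≡s
  ... | no x≢s  | inj₁ refl = ⊥-elim (proj₁ (noOther _ q) x≢s x∈A)
  ... | no x≢s  | inj₂ refl = ⊥-elim (proj₂ (noOther _ q) x≢s x∈A)

  InT'-distinct : {s t : Fin (n G)} → InT' I (s , t) → s ≢ t
  InT'-distinct (st∈T , _) = proj₁ (valid I) _ st∈T

  NoOtherTerminal⇒d-≤ : (s t : Fin (n G)) → InT' I (s , t) ⊎ InT' I (t , s) →
    (As Bt : V) → IsMinExt G (terms I) (A° I ∪ ⁅ s ⁆) (B° I ∪ ⁅ t ⁆) As Bt →
    (∀ p → InT' I p → ¬ SamePair p (s , t) → ¬ Resolves As Bt p) →
    (A : V) → (A° I ∪ ⁅ s ⁆) ⊆ A → Disjoint A (B° I) → NoOtherTerminal I s A →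
    d G As ≤ d G A
  NoOtherTerminal⇒d-≤ s t st As Bt min@(sep@(As#Bt , _) , (X⊆As , Y⊆Bt) , _) noRes A X⊆A A#B° noOther =
    IsMinExt-d-≤ G min X⊆A A#Y As≈A
    where
    s≢t : s ≢ t
    s≢t = [ InT'-distinct , (λ ts s≡t → InT'-distinct ts (sym s≡t)) ] st
    t∉A : t ∉ A
    t∉A t∈A = s≢t (sym ([ (λ q → NoOtherTerminal-endpoint noOther q (inj₂ refl) t∈A)
                         , (λ q → NoOtherTerminal-endpoint noOther q (inj₁ refl) t∈A) ] st))
    A#Y : Disjoint A (B° I ∪ ⁅ t ⁆)
    A#Y x x∈A x∈Y = [ A#B° x x∈A , (λ x∈⁅t⁆ → t∉A (subst (_∈ A) (x∈⁅y⁆⇒x≡y t x∈⁅t⁆) x∈A)) ]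
      (x∈p∪q⁻ (B° I) ⁅ t ⁆ x∈Y)
    As≈A : SameTerminals (terms I) As A
    As≈A p p∈T x e with IsTermSep-endpoint (sep° I) p∈T e
    ... | inj₁ (inj₁ x∈A°) = mk⇔ (λ _ → X⊆A (x∈p∪q⁺ (inj₁ x∈A°))) (λ _ → X⊆As (x∈p∪q⁺ (inj₁ x∈A°)))
    ... | inj₁ (inj₂ x∈B°) = mk⇔ (λ x∈As → ⊥-elim (As#Bt x x∈As (Y⊆Bt (x∈p∪q⁺ (inj₁ x∈B°)))))
                                 (λ x∈A → ⊥-elim (A#B° x x∈A x∈B°))
    ... | inj₂ unresolved = mk⇔ As→A A→As
      where
      A→As : x ∈ A → x ∈ As
      A→As x∈A with refl ← NoOtherTerminal-endpoint noOther (p∈T , unresolved) e x∈A =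
        X⊆As (x∈p∪q⁺ (inj₂ (x∈⁅x⁆ s)))
      As→A : x ∈ As → x ∈ A
      As→A x∈As with x ≟ s | x ≟ t
      ... | yes refl | _ = X⊆A (x∈p∪q⁺ (inj₂ (x∈⁅x⁆ s)))
      ... | no _ | yes refl = ⊥-elim (As#Bt t x∈As (Y⊆Bt (x∈p∪q⁺ (inj₂ (x∈⁅x⁆ t)))))
      ... | no x≢s | no x≢t = ⊥-elim (noRes p (p∈T , unresolved)
        (λ same → [ x≢s , x≢t ] (SamePair-endpoint same e))
        (IsTermSep-resolves sep p∈T e (x∈p∪q⁺ (inj₁ x∈As))))

swapSides : TSInstance → TSInstance
swapSides I = record
  { graph = graph I ; terms = terms I ; valid = valid I
  ; A° = B° I ; B° = A° I ; sep° = IsTermSep-swap (sep° I) ; k = k I }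

-- Applied to swapSides I it converts back, since swapSides (swapSides I) has the terms,
-- A° and B° of I definitionally.
InT'-swapSides : (I : TSInstance) {p : Pair (n (graph I))} → InT' I p → InT' (swapSides I) p
InT'-swapSides I (p∈T , unresolved) = p∈T , Unresolved-swap unresolved

lemma5p2 : (I : TSInstance) (s t : Fin (n (graph I))) →
  InT' I (s , t) ⊎ InT' I (t , s) →
  (As Bt At Bs : Subset (n (graph I))) →
  IsMinExt (graph I) (terms I) (A° I ∪ ⁅ s ⁆) (B° I ∪ ⁅ t ⁆) As Bt →
  IsMinExt (graph I) (terms I) (A° I ∪ ⁅ t ⁆) (B° I ∪ ⁅ s ⁆) At Bs →
  (∀ p → InT' I p → ¬ SamePair p (s , t) → ¬ Resolves As Bt p) →
  (∀ p → InT' I p → ¬ SamePair p (s , t) → ¬ Resolves At Bs p) →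
  (∀ (A : Subset (n (graph I))) → (A° I ∪ ⁅ s ⁆) ⊆ A → Disjoint A (B° I) →
     NoOtherTerminal I s A →
     dDiff (graph I) A (A° I) ≥ dDiff (graph I) As (A° I))
  × (∀ (B : Subset (n (graph I))) → (B° I ∪ ⁅ s ⁆) ⊆ B → Disjoint B (A° I) →
     NoOtherTerminal I s B →
     dDiff (graph I) B (B° I) ≥ dDiff (graph I) Bs (B° I))
lemma5p2 I s t st As Bt At Bs minₛ minₜ noResₛ noResₜ =
  (λ A X⊆A A#B° noOther → dDiff-monoˡ G (A° I)
     (NoOtherTerminal⇒d-≤ I s t st As Bt minₛ noResₛ A X⊆A A#B° noOther)) ,
  (λ B X⊆B B#A° noOther → dDiff-monoˡ G (B° I)
     (NoOtherTerminal⇒d-≤ (swapSides I) s t st′ Bs At (IsMinExt-swap G minₜ) noRes′ B X⊆B B#A°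
        (λ p → noOther p ∘ InT'-swapSides (swapSides I))))
  where
  G = graph I
  st′ : InT' (swapSides I) (s , t) ⊎ InT' (swapSides I) (t , s)
  st′ = Sum.map (InT'-swapSides I) (InT'-swapSides I) st
  noRes′ : ∀ p → InT' (swapSides I) p → ¬ SamePair p (s , t) → ¬ Resolves Bs At p
  noRes′ p q notSame = noResₜ p (InT'-swapSides (swapSides I) q) notSame ∘ Resolves-swap
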